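{- (Completeness of the Hilbert system with respect to the tableau system.) For every set of formulas $\Gamma$ and formula $A$ of the language of $\mathbb{L}(\nabla)$: if $\Gamma\Vdash A$ in the tableau system $\mathcal{T}_{L(P)}$, then $\Gamma\vdash A$ in $\mathbb{L}(\nabla)$.
   Context: Language: propositional formulas built from propositional variables with $\neg,\land,\lor,\to$ ($A\leftrightarrow B$ abbreviating $(A\to B)\land(B\to A)$), the constant $\bot$, and a unary operator $\nabla$. Hilbert system $\mathbb{L}(\nabla)$: axioms (Ax0) all instances of classical propositional tautologies; (Ax1) $(\nabla\varphi\land\nabla\psi)\to\nabla(\varphi\land\psi)$; (Ax2) $\nabla(\varphi\lor\neg\varphi)$; (Ax3) $\nabla\varphi\to\varphi$; rules Modus Ponens and (R$\nabla$): from $\vdash\varphi\to\psi$ infer $\vdash\nabla\varphi\to\nabla\psi$. $\Gamma\vdash A$ means there is a derivation of $A$ from premises in $\Gamma$ using these axioms and rules. Tableau system $\mathcal{T}_{L(P)}$: Smullyan's analytic tableau rules for classical propositional logic, extended by the following expansion rules for $\nabla$: (R1) from $\nabla A$ add $A$; (R2) if $\neg\nabla A$ occurs on a branch and $\Vdash A$ (i.e., the tableau starting from $\neg A$ closes), add $\bot$; (R3) from $\neg\nabla(A\land B)$ add $\neg\nabla A\lor\neg\nabla B$; (R4) from $\neg\nabla(A\lor B)$ add $\neg\nabla A\land\neg\nabla B$; (R5A) from $\neg\nabla(A\to B)$ add $\neg\nabla(\neg A\lor B)$; (R5B) from $\neg\nabla(A\leftrightarrow B)$ add $\neg\nabla((A\to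 B)\land(B\to A))$; (R6) from $A\leftrightarrow B$, where this biconditional is known to be valid ($\Vdash A\leftrightarrow B$), add $(\nabla A\land\nabla B)\lor(\neg\nabla A\land\neg\nabla B)$. A branch closes if it contains some formula $B$ and $\neg B$, or contains $\bot$; a tableau is closed if all its branches close. $\Gamma\Vdash A$ means there is a closed tableau starting from the formulas of $\Gamma$ together with $\neg A$; $\Vdash A$ means $\emptyset\Vdash A$. -}

module Defs where

open import Data.Nat using (ℕ)
open import Data.Bool using (Bool; true; false; not; if_then_else_) renaming (_∧_ to _&&_; _∨_ to _||_)
open import Data.List using (List; []; _∷_)
open import Data.List.Membership.Propositional using (_∈_)
open import Relation.Binary.PropositionalEquality using (_≡_)
open import Level using (Level) renaming (suc to lsuc; zero to lzero)
import Data.Empty as E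

infixr 4 _⇒_ _⇔_
infixr 5 _∨_
infixr 6 _∧_
infix 7 ~_ ∇_

data Fm : Set where
  var  : ℕ → Fm
  ⊥f   : Fm
  ~_   : Fm → Fm
  _∧_  : Fm → Fm → Fm
  _∨_  : Fm → Fm → Fm
  _⇒_  : Fm → Fm → Fm
  ∇_   : Fm → Fm

_⇔_ : Fm → Fm → Fm
A ⇔ B = (A ⇒ B) ∧ (B ⇒ A)

FmSet : Set₁
FmSet = Fm → Set

∅ : FmSet
∅ _ = E.⊥

-- Instances of classical propositional tautologies: formulas true under
-- every classical valuation in which propositional variables and
-- ∇-formulas (the maximal non-truth-functional subformulas) are
-- assigned arbitrary truth values.

eval : (ℕ → Bool) → (Fm → Bool) → Fm → Bool
eval v w (var n) = v n
eval v w ⊥f      = false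
eval v w (~ A)   = not (eval v w A)
eval v w (A ∧ B) = eval v w A && eval v w B
eval v w (A ∨ B) = eval v w A || eval v w B
eval v w (A ⇒ B) = not (eval v w A) || eval v w B
eval v w (∇ A)   = w (∇ A)

TautInst : Fm → Set
TautInst A = (v : ℕ → Bool) (w : Fm → Bool) → eval v w A ≡ true

-- Hilbert system L(∇).  Γ ⊢ A : derivation of A from premises in Γ.
-- Rule (R∇) applies only to theorems (derivations without premises).

infix 2 _⊢_

data _⊢_ : FmSet → Fm → Set₁ where
  hyp  : ∀ {Γ A} → Γ A → Γ ⊢ A
  ax0  : ∀ {Γ A} → TautInst A → Γ ⊢ A
  ax1  : ∀ {Γ φ ψ} → Γ ⊢ ((∇ φ ∧ ∇ ψ) ⇒ ∇ (φ ∧ ψ))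
  ax2  : ∀ {Γ φ} → Γ ⊢ ∇ (φ ∨ ~ φ)
  ax3  : ∀ {Γ φ} → Γ ⊢ (∇ φ ⇒ φ)
  mp   : ∀ {Γ A B} → Γ ⊢ (A ⇒ B) → Γ ⊢ A → Γ ⊢ B
  rnab : ∀ {Γ φ ψ} → ∅ ⊢ (φ ⇒ ψ) → Γ ⊢ (∇ φ ⇒ ∇ ψ)

-- Closes Γ br : the branch br (a finite list of formulas) can be
-- expanded, using Smullyan's rules, the ∇-rules R1–R6, and adding
-- formulas of Γ, into a finite tableau all of whose branches close.

data Closes : FmSet → List Fm → Set₁ where
  cl-contra : ∀ {Γ br B} → B ∈ br → (~ B) ∈ br → Closes Γ br
  cl-bot    : ∀ {Γ br} → ⊥f ∈ br → Closes Γ br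
  premise   : ∀ {Γ br B} → Γ B → Closes Γ (B ∷ br) → Closes Γ br
  dneg      : ∀ {Γ br A} → (~ (~ A)) ∈ br → Closes Γ (A ∷ br) → Closes Γ br
  α-∧       : ∀ {Γ br A B} → (A ∧ B) ∈ br → Closes Γ (A ∷ B ∷ br) → Closes Γ br
  α-¬∨      : ∀ {Γ br A B} → (~ (A ∨ B)) ∈ br → Closes Γ (~ A ∷ ~ B ∷ br) → Closes Γ br
  α-¬⇒      : ∀ {Γ br A B} → (~ (A ⇒ B)) ∈ br → Closes Γ (A ∷ ~ B ∷ br) → Closes Γ br
  β-∨       : ∀ {Γ br A B} → (A ∨ B) ∈ br → Closes Γ (A ∷ br) → Closes Γ (B ∷ br) → Closes Γ br
  β-¬∧      : ∀ {Γ br A B} → (~ (A ∧ B)) ∈ br → Closes Γ (~ A ∷ br) → Closes Γ (~ B ∷ br) → Closes Γ br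
  β-⇒       : ∀ {Γ br A B} → (A ⇒ B) ∈ br → Closes Γ (~ A ∷ br) → Closes Γ (B ∷ br) → Closes Γ br
  R1        : ∀ {Γ br A} → (∇ A) ∈ br → Closes Γ (A ∷ br) → Closes Γ br
  R2        : ∀ {Γ br A} → (~ (∇ A)) ∈ br → Closes ∅ (~ A ∷ []) → Closes Γ (⊥f ∷ br) → Closes Γ br
  R3        : ∀ {Γ br A B} → (~ (∇ (A ∧ B))) ∈ br → Closes Γ ((~ (∇ A) ∨ ~ (∇ B)) ∷ br) → Closes Γ br
  R4        : ∀ {Γ br A B} → (~ (∇ (A ∨ B))) ∈ br → Closes Γ ((~ (∇ A) ∧ ~ (∇ B)) ∷ br) → Closes Γ br
  R5A       : ∀ {Γ br A B} → (~ (∇ (A ⇒ B))) ∈ br → Closes Γ (~ (∇ (~ A ∨ B)) ∷ br) → Closes Γ br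
  R5B       : ∀ {Γ br A B} → (~ (∇ (A ⇔ B))) ∈ br → Closes Γ (~ (∇ ((A ⇒ B) ∧ (B ⇒ A))) ∷ br) → Closes Γ br
  R6        : ∀ {Γ br A B} → (A ⇔ B) ∈ br → Closes ∅ (~ (A ⇔ B) ∷ []) →
              Closes Γ (((∇ A ∧ ∇ B) ∨ (~ (∇ A) ∧ ~ (∇ B))) ∷ br) → Closes Γ br

infix 2 _⊩_
_⊩_ : FmSet → Fm → Set₁
Γ ⊩ A = Closes Γ (~ A ∷ [])

-- A closed tableau is read as a Hilbert derivation by identifying a branch with the
-- conjunction ⋀ br of its formulas: by induction on the tableau, a closed tableau below
-- br yields Γ ⊢ ⋀ br ⇒ ⊥.  Each expansion adds formulas that ⋀ br already implies, via a
-- propositional tautology for Smullyan's rules, Ax3 for R1, Ax1 for R3, and monotonicity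
-- (R∇) for R4 and R5A.  The side tableaux of R2 and R6 have no premises, so they yield
-- theorems, to which necessitation (R∇ applied to Ax2) and R∇ itself apply.
module Submission where

open import Defs
open import Data.Bool using (Bool; true; false; not; T) renaming (_∧_ to _&&_; _∨_ to _||_)
open import Data.Bool.Properties using (T-∧; T-≡)
open import Data.Fin using (Fin; zero; suc)
open import Data.List using (List; []; _∷_)
open import Data.List.Membership.Propositional using (_∈_)
open import Data.List.Relation.Unary.Any using (here; there)
open import Data.Nat using (ℕ)
open import Data.Product using (proj₁; proj₂)
open import Data.Vec using (Vec; []; _∷_; lookup; map)
open import Data.Vec.Properties using (lookup-map)
open import Function using (_∘_; Equivalence)
open import Relation.Binary.PropositionalEquality using (_≡_; refl; sym; trans; cong; cong₂)

open Equivalence using (to)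

-- Propositional schemas over n metavariables, whose validity is decided by enumerating
-- the 2ⁿ valuations; every instance of a valid schema is a tautology instance.

infixr 4 _⇒_
infixr 5 _∨_
infixr 6 _∧_
infix 7 ~_

data Schema (n : ℕ) : Set where
  atom : Fin n → Schema n
  ⊥f   : Schema n
  ~_   : Schema n → Schema n
  _∧_  : Schema n → Schema n → Schema n
  _∨_  : Schema n → Schema n → Schema n
  _⇒_  : Schema n → Schema n → Schema n

P : ∀ {n} → Schema (ℕ.suc n)
P = atom zero

Q : ∀ {n} → Schema (ℕ.suc (ℕ.suc n))
Q = atom (suc zero)

R : ∀ {n} → Schema (ℕ.suc (ℕ.suc (ℕ.suc n)))
R = atom (suc (suc zero))

instantiate : ∀ {n} → Vec Fm n → Schema n → Fm
instantiate σ (atom i) = lookup σ i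
instantiate σ ⊥f       = ⊥f
instantiate σ (~ φ)    = ~ instantiate σ φ
instantiate σ (φ ∧ ψ)  = instantiate σ φ ∧ instantiate σ ψ
instantiate σ (φ ∨ ψ)  = instantiate σ φ ∨ instantiate σ ψ
instantiate σ (φ ⇒ ψ)  = instantiate σ φ ⇒ instantiate σ ψ

evalSchema : ∀ {n} → Vec Bool n → Schema n → Bool
evalSchema ρ (atom i) = lookup ρ i
evalSchema ρ ⊥f       = false
evalSchema ρ (~ φ)    = not (evalSchema ρ φ)
evalSchema ρ (φ ∧ ψ)  = evalSchema ρ φ && evalSchema ρ ψ
evalSchema ρ (φ ∨ ψ)  = evalSchema ρ φ || evalSchema ρ ψ
evalSchema ρ (φ ⇒ ψ)  = not (evalSchema ρ φ) || evalSchema ρ ψ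

eval-instantiate : ∀ {n} v w (σ : Vec Fm n) (φ : Schema n) →
                   eval v w (instantiate σ φ) ≡ evalSchema (map (eval v w) σ) φ
eval-instantiate v w σ (atom i) = sym (lookup-map i (eval v w) σ)
eval-instantiate v w σ ⊥f       = refl
eval-instantiate v w σ (~ φ)    = cong not (eval-instantiate v w σ φ)
eval-instantiate v w σ (φ ∧ ψ)  = cong₂ _&&_ (eval-instantiate v w σ φ) (eval-instantiate v w σ ψ)
eval-instantiate v w σ (φ ∨ ψ)  = cong₂ _||_ (eval-instantiate v w σ φ) (eval-instantiate v w σ ψ)
eval-instantiate v w σ (φ ⇒ ψ)  =
  cong₂ (λ a b → not a || b) (eval-instantiate v w σ φ) (eval-instantiate v w σ ψ)

allValuations : ∀ n → (Vec Bool n → Bool) → Bool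
allValuations ℕ.zero    f = f []
allValuations (ℕ.suc n) f = allValuations n (f ∘ (true ∷_)) && allValuations n (f ∘ (false ∷_))

allValuations-sound : ∀ {n} (f : Vec Bool n → Bool) → T (allValuations n f) → ∀ ρ → T (f ρ)
allValuations-sound f holds []          = holds
allValuations-sound f holds (true ∷ ρ)  =
  allValuations-sound (f ∘ (true ∷_)) (proj₁ (to T-∧ holds)) ρ
allValuations-sound f holds (false ∷ ρ) =
  allValuations-sound (f ∘ (false ∷_)) (proj₂ (to T-∧ holds)) ρ

isValid : ∀ {n} → Schema n → Bool
isValid {n} φ = allValuations n (λ ρ → evalSchema ρ φ)

instance-tautInst : ∀ {n} (σ : Vec Fm n) (φ : Schema n) → T (isValid φ) → TautInst (instantiate σ φ)
instance-tautInst σ φ valid v w =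
  trans (eval-instantiate v w σ φ)
        (to T-≡ (allValuations-sound (λ ρ → evalSchema ρ φ) valid (map (eval v w) σ)))

taut : ∀ {n Γ} (σ : Vec Fm n) (φ : Schema n) {_ : T (isValid φ)} → Γ ⊢ instantiate σ φ
taut σ φ {valid} = ax0 (instance-tautInst σ φ valid)

⇒-trans : ∀ {Γ A B C} → Γ ⊢ A ⇒ B → Γ ⊢ B ⇒ C → Γ ⊢ A ⇒ C
⇒-trans {A = A} {B} {C} f g = mp (mp (taut (A ∷ B ∷ C ∷ []) ((P ⇒ Q) ⇒ (Q ⇒ R) ⇒ P ⇒ R)) f) g

⇒-weaken : ∀ {Γ A} C → Γ ⊢ A → Γ ⊢ C ⇒ A
⇒-weaken {A = A} C = mp (taut (A ∷ C ∷ []) (P ⇒ Q ⇒ P))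

∇-necessitation : ∀ {Γ A} → ∅ ⊢ A → Γ ⊢ ∇ A
∇-necessitation {A = A} d = mp (rnab (⇒-weaken (A ∨ ~ A) d)) ax2

¬∇-∧ : ∀ {Γ A B} → Γ ⊢ ~ (∇ (A ∧ B)) ⇒ ~ (∇ A) ∨ ~ (∇ B)
¬∇-∧ {A = A} {B} =
  mp (taut (∇ A ∷ ∇ B ∷ ∇ (A ∧ B) ∷ []) ((P ∧ Q ⇒ R) ⇒ ~ R ⇒ ~ P ∨ ~ Q)) ax1

¬∇-∨ : ∀ {Γ A B} → Γ ⊢ ~ (∇ (A ∨ B)) ⇒ ~ (∇ A) ∧ ~ (∇ B)
¬∇-∨ {A = A} {B} =
  mp (mp (taut (∇ A ∷ ∇ B ∷ ∇ (A ∨ B) ∷ []) ((P ⇒ R) ⇒ (Q ⇒ R) ⇒ ~ R ⇒ ~ P ∧ ~ Q))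
         (rnab (taut (A ∷ B ∷ []) (P ⇒ P ∨ Q))))
     (rnab (taut (A ∷ B ∷ []) (Q ⇒ P ∨ Q)))

¬∇-⇒ : ∀ {Γ A B} → Γ ⊢ ~ (∇ (A ⇒ B)) ⇒ ~ (∇ (~ A ∨ B))
¬∇-⇒ {A = A} {B} =
  mp (taut (∇ (~ A ∨ B) ∷ ∇ (A ⇒ B) ∷ []) ((P ⇒ Q) ⇒ ~ Q ⇒ ~ P))
     (rnab (taut (A ∷ B ∷ []) (~ P ∨ Q ⇒ P ⇒ Q)))

∇-cong : ∀ {Γ A B} → ∅ ⊢ A ⇔ B → Γ ⊢ (∇ A ∧ ∇ B) ∨ (~ (∇ A) ∧ ~ (∇ B))
∇-cong {A = A} {B} A⇔B =
  mp (mp (taut (∇ A ∷ ∇ B ∷ []) ((P ⇒ Q) ⇒ (Q ⇒ P) ⇒ (P ∧ Q) ∨ (~ P ∧ ~ Q)))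
         (rnab (mp (taut ((A ⇒ B) ∷ (B ⇒ A) ∷ []) (P ∧ Q ⇒ P)) A⇔B)))
     (rnab (mp (taut ((A ⇒ B) ∷ (B ⇒ A) ∷ []) (P ∧ Q ⇒ Q)) A⇔B))

⋀ : List Fm → Fm
⋀ []       = ~ ⊥f
⋀ (B ∷ br) = B ∧ ⋀ br

Refutes : FmSet → List Fm → Set₁
Refutes Γ br = Γ ⊢ ⋀ br ⇒ ⊥f

⋀-∈ : ∀ {Γ B br} → B ∈ br → Γ ⊢ ⋀ br ⇒ B
⋀-∈ {B = B} {_ ∷ br} (here refl)  = taut (B ∷ ⋀ br ∷ []) (P ∧ Q ⇒ P)
⋀-∈ {B = B} {C ∷ br} (there B∈br) = ⇒-trans (taut (C ∷ ⋀ br ∷ []) (P ∧ Q ⇒ Q)) (⋀-∈ B∈br)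

⋀-∈-⇒ : ∀ {Γ B X br} → B ∈ br → Γ ⊢ B ⇒ X → Γ ⊢ ⋀ br ⇒ X
⋀-∈-⇒ B∈br = ⇒-trans (⋀-∈ B∈br)

refutes-contradiction : ∀ {Γ br X} → Γ ⊢ ⋀ br ⇒ X → Γ ⊢ ⋀ br ⇒ ~ X → Refutes Γ br
refutes-contradiction {br = br} {X} d e =
  mp (mp (taut (⋀ br ∷ X ∷ []) ((P ⇒ Q) ⇒ (P ⇒ ~ Q) ⇒ P ⇒ ⊥f)) d) e

refutes-extend : ∀ {Γ br X} → Γ ⊢ ⋀ br ⇒ X → Refutes Γ (X ∷ br) → Refutes Γ br
refutes-extend {br = br} {X} d r =
  mp (mp (taut (⋀ br ∷ X ∷ []) ((P ⇒ Q) ⇒ (Q ∧ P ⇒ ⊥f) ⇒ P ⇒ ⊥f)) d) r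

refutes-extend₂ : ∀ {Γ br X Y} → Γ ⊢ ⋀ br ⇒ X → Γ ⊢ ⋀ br ⇒ Y →
                  Refutes Γ (X ∷ Y ∷ br) → Refutes Γ br
refutes-extend₂ {br = br} {X} {Y} d e r =
  mp (mp (mp (taut (⋀ br ∷ X ∷ Y ∷ [])
                   ((P ⇒ Q) ⇒ (P ⇒ R) ⇒ (Q ∧ R ∧ P ⇒ ⊥f) ⇒ P ⇒ ⊥f)) d) e) r

refutes-split : ∀ {Γ br X Y} → Γ ⊢ ⋀ br ⇒ X ∨ Y →
                Refutes Γ (X ∷ br) → Refutes Γ (Y ∷ br) → Refutes Γ br
refutes-split {br = br} {X} {Y} d r s =
  mp (mp (mp (taut (⋀ br ∷ X ∷ Y ∷ [])
                   ((P ⇒ Q ∨ R) ⇒ (Q ∧ P ⇒ ⊥f) ⇒ (R ∧ P ⇒ ⊥f) ⇒ P ⇒ ⊥f)) d) r) s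

refutation-derives : ∀ {Γ A} → Refutes Γ (~ A ∷ []) → Γ ⊢ A
refutation-derives {A = A} = mp (taut (A ∷ []) ((~ P ∧ ~ ⊥f ⇒ ⊥f) ⇒ P))

closed-refutes : ∀ {Γ br} → Closes Γ br → Refutes Γ br
closed-refutes (cl-contra B∈br ~B∈br) = refutes-contradiction (⋀-∈ B∈br) (⋀-∈ ~B∈br)
closed-refutes (cl-bot ⊥∈br)          = ⋀-∈ ⊥∈br
closed-refutes (premise ΓB c)         = refutes-extend (⇒-weaken _ (hyp ΓB)) (closed-refutes c)
closed-refutes (dneg {A = A} m c)     =
  refutes-extend (⋀-∈-⇒ m (taut (A ∷ []) (~ ~ P ⇒ P))) (closed-refutes c)
closed-refutes (α-∧ {A = A} {B} m c)  =
  refutes-extend₂ (⋀-∈-⇒ m (taut (A ∷ B ∷ []) (P ∧ Q ⇒ P)))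
                  (⋀-∈-⇒ m (taut (A ∷ B ∷ []) (P ∧ Q ⇒ Q))) (closed-refutes c)
closed-refutes (α-¬∨ {A = A} {B} m c) =
  refutes-extend₂ (⋀-∈-⇒ m (taut (A ∷ B ∷ []) (~ (P ∨ Q) ⇒ ~ P)))
                  (⋀-∈-⇒ m (taut (A ∷ B ∷ []) (~ (P ∨ Q) ⇒ ~ Q))) (closed-refutes c)
closed-refutes (α-¬⇒ {A = A} {B} m c) =
  refutes-extend₂ (⋀-∈-⇒ m (taut (A ∷ B ∷ []) (~ (P ⇒ Q) ⇒ P)))
                  (⋀-∈-⇒ m (taut (A ∷ B ∷ []) (~ (P ⇒ Q) ⇒ ~ Q))) (closed-refutes c)
closed-refutes (β-∨ m c d)            = refutes-split (⋀-∈ m) (closed-refutes c) (closed-refutes d)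
closed-refutes (β-¬∧ {A = A} {B} m c d) =
  refutes-split (⋀-∈-⇒ m (taut (A ∷ B ∷ []) (~ (P ∧ Q) ⇒ ~ P ∨ ~ Q)))
                (closed-refutes c) (closed-refutes d)
closed-refutes (β-⇒ {A = A} {B} m c d) =
  refutes-split (⋀-∈-⇒ m (taut (A ∷ B ∷ []) ((P ⇒ Q) ⇒ ~ P ∨ Q)))
                (closed-refutes c) (closed-refutes d)
closed-refutes (R1 m c)   = refutes-extend (⋀-∈-⇒ m ax3) (closed-refutes c)
-- The branch already contradicts the theorem ∇ A, so the ⊥-extension of R2 is not needed.
closed-refutes (R2 m c _) =
  refutes-contradiction (⇒-weaken _ (∇-necessitation (refutation-derives (closed-refutes c))))
                        (⋀-∈ m)
closed-refutes (R3 m c)   = refutes-extend (⋀-∈-⇒ m ¬∇-∧) (closed-refutes c)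
closed-refutes (R4 m c)   = refutes-extend (⋀-∈-⇒ m ¬∇-∨) (closed-refutes c)
closed-refutes (R5A m c)  = refutes-extend (⋀-∈-⇒ m ¬∇-⇒) (closed-refutes c)
-- Since ⇔ is an abbreviation, R5B adds the very formula it started from.
closed-refutes (R5B m c)  = refutes-extend (⋀-∈ m) (closed-refutes c)
closed-refutes (R6 _ c d) =
  refutes-extend (⇒-weaken _ (∇-cong (refutation-derives (closed-refutes c)))) (closed-refutes d)

mainTheorem4 : (Γ : FmSet) (A : Fm) → Γ ⊩ A → Γ ⊢ A
mainTheorem4 Γ A c = refutation-derives (closed-refutes c)
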